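{- Define $p_n(t)\in\mathbb Z[t]$ by $p_0=1$, $p_1=0$ and $p_{n+1}(t)=-2nt\,p_n(t)+6(t^2-1)p_n'(t)-n(n+11)p_{n-1}(t)$ for $n\ge1$. Then for all $m\ge0$, $p_{2m}(0)\equiv1\bmod5$ if $m$ is even and $p_{2m}(0)\equiv3\bmod5$ if $m$ is odd. -}

module Defs where

open import Data.Nat as ℕ using (ℕ; zero; suc)
open import Data.Integer as ℤ using (ℤ; +_; -_)
open import Data.List using (List; []; _∷_)

-- Polynomials in ℤ[t] as coefficient lists, lowest degree first:
-- a₀ ∷ a₁ ∷ … represents a₀ + a₁ t + …  (trailing zeros allowed).
Poly : Set
Poly = List ℤ

_⊕_ : Poly → Poly → Poly
[] ⊕ q = q
(a ∷ p) ⊕ [] = a ∷ p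
(a ∷ p) ⊕ (b ∷ q) = (a ℤ.+ b) ∷ (p ⊕ q)

_·_ : ℤ → Poly → Poly
c · [] = []
c · (a ∷ p) = (c ℤ.* a) ∷ (c · p)

mulT : Poly → Poly
mulT p = + 0 ∷ p

private
  derivAux : ℕ → Poly → Poly
  derivAux k [] = []
  derivAux k (a ∷ p) = ((+ k) ℤ.* a) ∷ derivAux (suc k) p

deriv : Poly → Poly
deriv [] = []
deriv (a ∷ p) = derivAux 1 p

eval0 : Poly → ℤ
eval0 [] = + 0
eval0 (a ∷ _) = a

open import Data.Product using (_×_; _,_; proj₁)

pPair : ℕ → Poly × Poly
pPair zero = (+ 1 ∷ []) , []
pPair (suc k) with pPair k
... | (q , r) =
  let n = suc k in
  r , ((((- (+ (2 ℕ.* n))) · mulT r)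
        ⊕ ((+ 6) · (mulT (mulT (deriv r)) ⊕ ((- + 1) · deriv r))))
        ⊕ ((- (+ (n ℕ.* (n ℕ.+ 11)))) · q))

p : ℕ → Poly
p n = proj₁ (pPair n)

-- Modulo 5, the coefficients of t⁰, …, t⁴ of pₙ₋₁ and pₙ determine those of pₙ₊₁: multiplication
-- by t and differentiation map this window to itself, because the coefficient that
-- differentiation brings in from t⁵ is 5 a₅ ≡ 0. The coefficients of the recurrence depend on n
-- only modulo 5, and a computation shows that the windows of (p₂₀, p₂₁) agree with those of
-- (p₀, p₁) modulo 5. Hence the window of pₙ modulo 5 is periodic in n with period 20, and the
-- constant term of p₂ₘ modulo 5 follows from the ten values for m < 10.
module Submission where

open import Defs
open import Data.Nat using (ℕ; _*_; _%_)
open import Data.Integer using (+_; _-_)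
open import Data.Integer.Divisibility using (_∣_)
open import Data.Product using (_×_)
open import Relation.Binary.PropositionalEquality using (_≡_)

open import Data.Nat using (zero; suc; _+_; _/_; _<_; z<s; s<s; NonZero; >-nonZero⁻¹)
import Data.Nat.Properties as ℕ
import Data.Nat.DivMod as ℕ
import Data.Nat.Divisibility as ℕ
import Data.Nat.Tactic.RingSolver as ℕ-Solver
open import Data.Integer as ℤ using (ℤ; -_; _%ℕ_; _/ℕ_)
import Data.Integer.Properties as ℤ
import Data.Integer.DivMod as ℤ
import Data.Integer.Divisibility.Signed as Signed
import Data.Integer.Tactic.RingSolver as ℤ-Solver
open import Data.List using ([]; _∷_; map; take)
open import Data.Product using (_,_)
open import Data.Sum using (inj₁; inj₂)
open import Function using (_∘_)
open import Relation.Binary.Bundles using (Setoid)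
open import Relation.Binary.Definitions using (Decidable)
open import Relation.Binary.Structures using (IsEquivalence)
open import Relation.Binary.PropositionalEquality using (refl; sym; trans; cong; subst; subst₂)
import Relation.Binary.Reasoning.Setoid as SetoidReasoning
open import Relation.Nullary.Decidable using (from-yes; map′)

infix 4 _≡_mod_

record _≡_mod_ (a b d : ℤ) : Set where
  constructor ≡-mod
  field divides-difference : d Signed.∣ a - b

open _≡_mod_

≡-mod? : ∀ d → Decidable (λ a b → a ≡ b mod d)
≡-mod? d a b = map′ ≡-mod divides-difference (d Signed.∣? (a - b))

module _ {d : ℤ} where

  ≡-mod-refl : ∀ {a} → a ≡ a mod d
  ≡-mod-refl {a} = ≡-mod (Signed.divides (+ 0) (ℤ.+-inverseʳ a))

  ≡-mod-sym : ∀ {a b} → a ≡ b mod d → b ≡ a mod d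
  ≡-mod-sym {a} {b} (≡-mod d∣a-b) = ≡-mod (subst (d Signed.∣_) (swap a b) (Signed.∣m⇒∣-m d∣a-b))
    where
    swap : ∀ a b → - (a - b) ≡ b - a
    swap = ℤ-Solver.solve-∀

  ≡-mod-trans : ∀ {a b c} → a ≡ b mod d → b ≡ c mod d → a ≡ c mod d
  ≡-mod-trans {a} {b} {c} (≡-mod d∣a-b) (≡-mod d∣b-c) =
    ≡-mod (subst (d Signed.∣_) (ℤ.+-minus-telescope a b c) (Signed.∣m∣n⇒∣m+n d∣a-b d∣b-c))

  ≡-mod-resp-≡ : ∀ {a a′ b b′} → a′ ≡ a → b′ ≡ b → a ≡ b mod d → a′ ≡ b′ mod d
  ≡-mod-resp-≡ refl refl a≡b = a≡b

  -‿cong-mod : ∀ {a b} → a ≡ b mod d → - a ≡ - b mod d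
  -‿cong-mod {a} {b} (≡-mod d∣a-b) = ≡-mod (subst (d Signed.∣_) (negate a b) (Signed.∣m⇒∣-m d∣a-b))
    where
    negate : ∀ a b → - (a - b) ≡ - a - - b
    negate = ℤ-Solver.solve-∀

  +-cong-mod : ∀ {a a′ b b′} → a ≡ a′ mod d → b ≡ b′ mod d → a ℤ.+ b ≡ a′ ℤ.+ b′ mod d
  +-cong-mod {a} {a′} {b} {b′} (≡-mod d∣a-a′) (≡-mod d∣b-b′) =
    ≡-mod (subst (d Signed.∣_) (regroup a a′ b b′) (Signed.∣m∣n⇒∣m+n d∣a-a′ d∣b-b′))
    where
    regroup : ∀ a a′ b b′ → (a - a′) ℤ.+ (b - b′) ≡ (a ℤ.+ b) - (a′ ℤ.+ b′)
    regroup = ℤ-Solver.solve-∀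

  *-cong-mod : ∀ {a a′ b b′} → a ≡ a′ mod d → b ≡ b′ mod d → a ℤ.* b ≡ a′ ℤ.* b′ mod d
  *-cong-mod {a} {a′} {b} {b′} (≡-mod d∣a-a′) (≡-mod d∣b-b′) =
    ≡-mod (subst (d Signed.∣_) (regroup a a′ b b′)
      (Signed.∣m∣n⇒∣m+n (Signed.∣n⇒∣m*n a d∣b-b′) (Signed.∣m⇒∣m*n b′ d∣a-a′)))
    where
    regroup : ∀ a a′ b b′ → a ℤ.* (b - b′) ℤ.+ (a - a′) ℤ.* b′ ≡ a ℤ.* b - a′ ℤ.* b′
    regroup = ℤ-Solver.solve-∀

  multiple-+-≡-mod : ∀ k a → k ℤ.* d ℤ.+ a ≡ a mod d
  multiple-+-≡-mod k a = ≡-mod (Signed.divides k (cancel k a d))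
    where
    cancel : ∀ k a d → k ℤ.* d ℤ.+ a - a ≡ k ℤ.* d
    cancel = ℤ-Solver.solve-∀

  multiples-≡-mod : ∀ a b → d ℤ.* a ≡ d ℤ.* b mod d
  multiples-≡-mod a b = ≡-mod (Signed.divides (a - b) (factor a b d))
    where
    factor : ∀ a b d → d ℤ.* a - d ℤ.* b ≡ (a - b) ℤ.* d
    factor = ℤ-Solver.solve-∀

≡-mod-setoid : ℤ → Setoid _ _
Setoid.Carrier (≡-mod-setoid d)                             = ℤ
Setoid._≈_ (≡-mod-setoid d) a b                             = a ≡ b mod d
IsEquivalence.refl (Setoid.isEquivalence (≡-mod-setoid d))  = ≡-mod-refl
IsEquivalence.sym (Setoid.isEquivalence (≡-mod-setoid d))   = ≡-mod-sym
IsEquivalence.trans (Setoid.isEquivalence (≡-mod-setoid d)) = ≡-mod-trans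

pos-multiple-+-≡-mod : ∀ {d} k n → + (k * d + n) ≡ + n mod + d
pos-multiple-+-≡-mod {d} k n = ≡-mod-resp-≡ cast refl (multiple-+-≡-mod (+ k) (+ n))
  where
  cast : + (k * d + n) ≡ + k ℤ.* + d ℤ.+ + n
  cast = trans (ℤ.pos-+ (k * d) n) (cong (ℤ._+ + n) (ℤ.pos-* k d))

%ℕ-≡-mod : ∀ a d .{{_ : NonZero d}} → + (a %ℕ d) ≡ a mod + d
%ℕ-≡-mod a d = ≡-mod (Signed.divides (- (a /ℕ d))
  (subst (λ x → + (a %ℕ d) - x ≡ - (a /ℕ d) ℤ.* + d) (sym (ℤ.a≡a%ℕn+[a/ℕn]*n a d))
    (cancel (+ (a %ℕ d)) (a /ℕ d) (+ d))))
  where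
  cancel : ∀ r q d → r - (r ℤ.+ q ℤ.* d) ≡ - q ℤ.* d
  cancel = ℤ-Solver.solve-∀

coeff : Poly → ℕ → ℤ
coeff []      i       = + 0
coeff (a ∷ q) zero    = a
coeff (a ∷ q) (suc i) = coeff q i

eval0≡coeff0 : ∀ q → eval0 q ≡ coeff q 0
eval0≡coeff0 []      = refl
eval0≡coeff0 (a ∷ q) = refl

coeff-⊕ : ∀ q r i → coeff (q ⊕ r) i ≡ coeff q i ℤ.+ coeff r i
coeff-⊕ []      r       i       = sym (ℤ.+-identityˡ (coeff r i))
coeff-⊕ (a ∷ q) []      i       = sym (ℤ.+-identityʳ (coeff (a ∷ q) i))
coeff-⊕ (a ∷ q) (b ∷ r) zero    = refl
coeff-⊕ (a ∷ q) (b ∷ r) (suc i) = coeff-⊕ q r i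

coeff-· : ∀ c q i → coeff (c · q) i ≡ c ℤ.* coeff q i
coeff-· c []      i       = sym (ℤ.*-zeroʳ c)
coeff-· c (a ∷ q) zero    = refl
coeff-· c (a ∷ q) (suc i) = coeff-· c q i

coeff-map : ∀ f → f (+ 0) ≡ + 0 → ∀ q i → coeff (map f q) i ≡ f (coeff q i)
coeff-map f f0≡0 []      i       = sym f0≡0
coeff-map f f0≡0 (a ∷ q) zero    = refl
coeff-map f f0≡0 (a ∷ q) (suc i) = coeff-map f f0≡0 q i

coeff-take : ∀ {k i} q → i < k → coeff (take k q) i ≡ coeff q i
coeff-take {suc k}         []      _         = refl
coeff-take {suc k} {zero}  (a ∷ q) _         = refl
coeff-take {suc k} {suc i} (a ∷ q) (s<s i<k) = coeff-take q i<k

-- The accumulating helper of deriv is private, so the formula is checked case by case.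
coeff-deriv : ∀ q {i} → i < 5 → coeff (deriv q) i ≡ + suc i ℤ.* coeff q (suc i)
coeff-deriv []                          {0} _ = refl
coeff-deriv (_ ∷ [])                    {0} _ = refl
coeff-deriv (_ ∷ _ ∷ _)                 {0} _ = refl
coeff-deriv []                          {1} _ = refl
coeff-deriv (_ ∷ [])                    {1} _ = refl
coeff-deriv (_ ∷ _ ∷ [])                {1} _ = refl
coeff-deriv (_ ∷ _ ∷ _ ∷ _)             {1} _ = refl
coeff-deriv []                          {2} _ = refl
coeff-deriv (_ ∷ [])                    {2} _ = refl
coeff-deriv (_ ∷ _ ∷ [])                {2} _ = refl
coeff-deriv (_ ∷ _ ∷ _ ∷ [])            {2} _ = refl
coeff-deriv (_ ∷ _ ∷ _ ∷ _ ∷ _)         {2} _ = refl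
coeff-deriv []                          {3} _ = refl
coeff-deriv (_ ∷ [])                    {3} _ = refl
coeff-deriv (_ ∷ _ ∷ [])                {3} _ = refl
coeff-deriv (_ ∷ _ ∷ _ ∷ [])            {3} _ = refl
coeff-deriv (_ ∷ _ ∷ _ ∷ _ ∷ [])        {3} _ = refl
coeff-deriv (_ ∷ _ ∷ _ ∷ _ ∷ _ ∷ _)     {3} _ = refl
coeff-deriv []                          {4} _ = refl
coeff-deriv (_ ∷ [])                    {4} _ = refl
coeff-deriv (_ ∷ _ ∷ [])                {4} _ = refl
coeff-deriv (_ ∷ _ ∷ _ ∷ [])            {4} _ = refl
coeff-deriv (_ ∷ _ ∷ _ ∷ _ ∷ [])        {4} _ = refl
coeff-deriv (_ ∷ _ ∷ _ ∷ _ ∷ _ ∷ [])    {4} _ = refl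
coeff-deriv (_ ∷ _ ∷ _ ∷ _ ∷ _ ∷ _ ∷ _) {4} _ = refl
coeff-deriv _ {suc (suc (suc (suc (suc _))))} (s<s (s<s (s<s (s<s (s<s ())))))

module LowCoefficients (d k : ℕ) .{{_ : NonZero d}} where

  infix 4 _≈_

  record _≈_ (q r : Poly) : Set where
    constructor agree
    field coeff-≡-mod : ∀ {i} → i < k → coeff q i ≡ coeff r i mod + d

  open _≈_ public

  _≈?_ : Decidable _≈_
  q ≈? r = map′ agree coeff-≡-mod (ℕ.allUpTo? (λ i → ≡-mod? (+ d) (coeff q i) (coeff r i)) k)

  ≈-refl : ∀ {q} → q ≈ q
  ≈-refl = agree (λ _ → ≡-mod-refl)

  ≈-sym : ∀ {q r} → q ≈ r → r ≈ q
  ≈-sym (agree q≈r) = agree (≡-mod-sym ∘ q≈r)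

  ≈-trans : ∀ {q r s} → q ≈ r → r ≈ s → q ≈ s
  ≈-trans (agree q≈r) (agree r≈s) = agree (λ i<k → ≡-mod-trans (q≈r i<k) (r≈s i<k))

  ⊕-cong : ∀ {q q′ r r′} → q ≈ q′ → r ≈ r′ → q ⊕ r ≈ q′ ⊕ r′
  ⊕-cong {q} {q′} {r} {r′} (agree q≈q′) (agree r≈r′) = agree λ {i} i<k →
    ≡-mod-resp-≡ (coeff-⊕ q r i) (coeff-⊕ q′ r′ i) (+-cong-mod (q≈q′ i<k) (r≈r′ i<k))

  ·-cong : ∀ {c c′ q q′} → c ≡ c′ mod + d → q ≈ q′ → c · q ≈ c′ · q′
  ·-cong {c} {c′} {q} {q′} c≡c′ (agree q≈q′) = agree λ {i} i<k →
    ≡-mod-resp-≡ (coeff-· c q i) (coeff-· c′ q′ i) (*-cong-mod c≡c′ (q≈q′ i<k))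

  mulT-cong : ∀ {q q′} → q ≈ q′ → mulT q ≈ mulT q′
  mulT-cong {q} {q′} (agree q≈q′) = agree shifted
    where
    shifted : ∀ {i} → i < k → coeff (mulT q) i ≡ coeff (mulT q′) i mod + d
    shifted {zero}  _         = ≡-mod-refl
    shifted {suc i} (s<s i<k) = q≈q′ (ℕ.m<n⇒m<1+n i<k)

  reduce : Poly → Poly
  reduce = take k ∘ map (λ a → + (a %ℕ d))

  reduce-≈ : ∀ q → reduce q ≈ q
  reduce-≈ q = agree λ {i} i<k → ≡-mod-resp-≡ (reduced-coeff i<k) refl (%ℕ-≡-mod (coeff q i) d)
    where
    reduced-coeff : ∀ {i} → i < k → coeff (reduce q) i ≡ + (coeff q i %ℕ d)
    reduced-coeff {i} i<k = trans (coeff-take (map _ q) i<k)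
      (coeff-map _ (cong +_ (ℕ.m<n⇒m%n≡m (>-nonZero⁻¹ d))) q i)

open LowCoefficients 5 5

deriv-cong : ∀ {q r} → q ≈ r → deriv q ≈ deriv r
deriv-cong {q} {r} (agree q≈r) = agree λ i<5 →
  ≡-mod-resp-≡ (coeff-deriv q i<5) (coeff-deriv r i<5) (scaled i<5)
  where
  scaled : ∀ {i} → i < 5 → + suc i ℤ.* coeff q (suc i) ≡ + suc i ℤ.* coeff r (suc i) mod + 5
  scaled {i} i<5 with ℕ.m<1+n⇒m<n∨m≡n i<5
  ... | inj₁ i<4  = *-cong-mod (≡-mod-refl {a = + suc i}) (q≈r (s<s i<4))
  ... | inj₂ refl = multiples-≡-mod (coeff q 5) (coeff r 5)

recurrence : ℕ → Poly → Poly → Poly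
recurrence n q r =
  (((- (+ (2 * n))) · mulT r) ⊕ ((+ 6) · (mulT (mulT (deriv r)) ⊕ ((- + 1) · deriv r))))
  ⊕ ((- (+ (n * (n + 11)))) · q)

p-recurrence : ∀ n → p (2 + n) ≡ recurrence (suc n) (p n) (p (suc n))
p-recurrence _ = refl

recurrence-cong : ∀ {n n′ q q′ r r′} → + n ≡ + n′ mod + 5 → q ≈ q′ → r ≈ r′ →
                  recurrence n q r ≈ recurrence n′ q′ r′
recurrence-cong {n} {n′} {r = r} {r′} n≡n′ q≈q′ r≈r′ =
  ⊕-cong
    (⊕-cong (·-cong (-‿cong-mod linear) (mulT-cong r≈r′))
            (·-cong ≡-mod-refl (⊕-cong (mulT-cong (mulT-cong dr≈dr′)) (·-cong ≡-mod-refl dr≈dr′))))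
    (·-cong (-‿cong-mod quadratic) q≈q′)
  where
  dr≈dr′ : deriv r ≈ deriv r′
  dr≈dr′ = deriv-cong r≈r′
  linear : + (2 * n) ≡ + (2 * n′) mod + 5
  linear = ≡-mod-resp-≡ (ℤ.pos-* 2 n) (ℤ.pos-* 2 n′) (*-cong-mod (≡-mod-refl {a = + 2}) n≡n′)
  cast : ∀ m → + (m * (m + 11)) ≡ + m ℤ.* (+ m ℤ.+ + 11)
  cast m = trans (ℤ.pos-* m (m + 11)) (cong (+ m ℤ.*_) (ℤ.pos-+ m 11))
  quadratic : + (n * (n + 11)) ≡ + (n′ * (n′ + 11)) mod + 5
  quadratic = ≡-mod-resp-≡ (cast n) (cast n′) (*-cong-mod n≡n′ (+-cong-mod n≡n′ (≡-mod-refl {a = + 11})))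

recurrence-periodic : ∀ (u : ℕ → Poly) → (∀ n → u (2 + n) ≡ recurrence (suc n) (u n) (u (suc n))) →
                      u 20 ≈ u 0 → u 21 ≈ u 1 → ∀ n → u (20 + n) ≈ u n
recurrence-periodic u u-rec u₂₀≈u₀ u₂₁≈u₁ 0             = u₂₀≈u₀
recurrence-periodic u u-rec u₂₀≈u₀ u₂₁≈u₁ 1             = u₂₁≈u₁
recurrence-periodic u u-rec u₂₀≈u₀ u₂₁≈u₁ (suc (suc n)) =
  subst₂ _≈_ (sym (u-rec (20 + n))) (sym (u-rec n))
    (recurrence-cong (pos-multiple-+-≡-mod 4 (suc n)) (periodic n) (periodic (suc n)))
  where
  periodic : ∀ n → u (20 + n) ≈ u n
  periodic = recurrence-periodic u u-rec u₂₀≈u₀ u₂₁≈u₁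

periodic-multiple : ∀ (u : ℕ → Poly) → (∀ n → u (20 + n) ≈ u n) → ∀ k n → u (k * 20 + n) ≈ u n
periodic-multiple u u-periodic zero    n = ≈-refl
periodic-multiple u u-periodic (suc k) n = ≈-trans (u-periodic (k * 20 + n)) (periodic-multiple u u-periodic k n)

-- Normalising p 20 itself is infeasible (its coefficients are huge and its unfolding is not
-- shared); reducing modulo 5 after every step keeps every term small.
reduced : ℕ → Poly
reduced 0             = + 1 ∷ []
reduced 1             = []
reduced (suc (suc n)) = reduce (recurrence (suc n) (reduced n) (reduced (suc n)))

reduced-≈ : ∀ n → reduced n ≈ p n
reduced-≈ 0             = ≈-refl
reduced-≈ 1             = ≈-refl
reduced-≈ (suc (suc n)) =
  ≈-trans (reduce-≈ _) (recurrence-cong ≡-mod-refl (reduced-≈ n) (reduced-≈ (suc n)))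

p-≈-from-reduced : ∀ m n → reduced m ≈ reduced n → p m ≈ p n
p-≈-from-reduced m n rm≈rn = ≈-trans (≈-sym (reduced-≈ m)) (≈-trans rm≈rn (reduced-≈ n))

p-periodic : ∀ n → p (20 + n) ≈ p n
p-periodic = recurrence-periodic p p-recurrence
  (p-≈-from-reduced 20 0 (from-yes (reduced 20 ≈? reduced 0)))
  (p-≈-from-reduced 21 1 (from-yes (reduced 21 ≈? reduced 1)))

reduced-even-constant-terms : ∀ {r} → r < 10 → coeff (reduced (2 * r)) 0 ≡ + (1 + 2 * (r % 2)) mod + 5
reduced-even-constant-terms =
  from-yes (ℕ.allUpTo? (λ r → ≡-mod? (+ 5) (coeff (reduced (2 * r)) 0) (+ (1 + 2 * (r % 2)))) 10)

p-even-constant-term : ∀ m → eval0 (p (2 * m)) ≡ + (1 + 2 * (m % 2)) mod + 5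
p-even-constant-term m = begin
  eval0 (p (2 * m))                ≡⟨ eval0≡coeff0 (p (2 * m)) ⟩
  coeff (p (2 * m)) 0              ≡⟨ cong (λ n → coeff (p n) 0) two-m ⟩
  coeff (p (m / 10 * 20 + 2 * r)) 0 ≈⟨ coeff-≡-mod (periodic-multiple p p-periodic (m / 10) (2 * r)) z<s ⟩
  coeff (p (2 * r)) 0              ≈⟨ coeff-≡-mod (reduced-≈ (2 * r)) z<s ⟨
  coeff (reduced (2 * r)) 0        ≈⟨ reduced-even-constant-terms (ℕ.m%n<n m 10) ⟩
  + (1 + 2 * (r % 2))              ≡⟨ cong (λ b → + (1 + 2 * b)) r%2≡m%2 ⟩
  + (1 + 2 * (m % 2))              ∎
  where
  open SetoidReasoning (≡-mod-setoid (+ 5))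
  r : ℕ
  r = m % 10
  distribute : ∀ r q → 2 * (r + q * 10) ≡ q * 20 + 2 * r
  distribute = ℕ-Solver.solve-∀
  two-m : 2 * m ≡ m / 10 * 20 + 2 * r
  two-m = trans (cong (2 *_) (ℕ.m≡m%n+[m/n]*n m 10)) (distribute r (m / 10))
  r%2≡m%2 : r % 2 ≡ m % 2
  r%2≡m%2 = ℕ.m∣n⇒o%n%m≡o%m 2 10 m (ℕ.divides 5 refl)

proposition5p1 : (m : ℕ) → (m % 2 ≡ 0 → (+ 5) ∣ (eval0 (p (2 * m)) - + 1)) × (m % 2 ≡ 1 → (+ 5) ∣ (eval0 (p (2 * m)) - + 3))
proposition5p1 m = residue , residue
  where
  residue : ∀ {b} → m % 2 ≡ b → + 5 ∣ eval0 (p (2 * m)) - + (1 + 2 * b)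
  residue refl = Signed.∣⇒∣ᵤ (divides-difference (p-even-constant-term m))
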